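{- Let $x_1,x_2,x_3$ be nonnegative integers with $x_1+x_2+x_3=r\ge 3$. Let $C$ be a set of $r$ vertices and for a simple graph $G$ on $C$ let $S(G)$ be the graph obtained from $G$ by attaching a new pendant edge at each vertex of $C$ (with distinct new end vertices). Fix a coloring of the pendant edges with colors $1,2,3$ in which exactly $x_i$ pendant edges receive color $i$. Then there exists a $2$-regular simple graph $G$ on $C$ such that this coloring extends to a proper edge coloring of $S(G)$ with the colors $1,2,3$ if and only if $x_1,x_2,x_3$ and $r$ all have the same parity; if they do not, no $2$-regular simple graph $G$ on $C$ has this property. Moreover, if exactly one of $x_1,x_2,x_3$ is nonzero and $r$ is even, then for every cycle $G$ through all vertices of $C$ the coloring of the pendant edges extends to a proper edge coloring of $S(G)$ with the colors $1,2,3$.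
   Context: A proper edge coloring assigns colors to edges so that edges sharing an end vertex get different colors. -}

module Defs where

open import Data.Nat using (ℕ; zero; suc; _+_; _%_)
open import Data.Bool using (Bool; true; false)
import Data.Bool as B
open import Data.Fin using (Fin; toℕ)
import Data.Fin as F
open import Data.List using (List; length; filter; allFin)
open import Data.Fin.Permutation using (Permutation′; _⟨$⟩ʳ_)
open import Relation.Binary.PropositionalEquality using (_≡_; _≢_)
open import Data.Sum using (_⊎_)
open import Data.Product using (Σ; _×_)

record SimpleGraph (r : ℕ) : Set where
  field
    adj     : Fin r → Fin r → Bool
    sym     : ∀ i j → adj i j ≡ adj j i
    irrefl  : ∀ i → adj i i ≡ false
open SimpleGraph public

degree : ∀ {r} → SimpleGraph r → Fin r → ℕ
degree {r} G i = length (filter (λ j → adj G i j B.≟ true) (allFin r))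

TwoRegular : ∀ {r} → SimpleGraph r → Set
TwoRegular {r} G = ∀ (i : Fin r) → degree G i ≡ 2

-- number of pendant edges (indexed by their vertex in C) receiving colour k
colourCount : ∀ {r} → (Fin r → Fin 3) → Fin 3 → ℕ
colourCount {r} p k = length (filter (λ i → p i F.≟ k) (allFin r))

-- The pendant edge at vertex i of C has colour p i.  An extension of p to a
-- proper edge colouring of S(G) with colours {1,2,3} (= Fin 3) is a colouring
-- c of the edges of G (c i j is the colour of edge ij, symmetric on edges)
-- such that at every vertex i of C all incident edges (the pendant edge and
-- the G-edges) get distinct colours.  The new pendant end vertices have
-- degree 1, so impose no constraint.
record ProperExtension {r} (G : SimpleGraph r) (p : Fin r → Fin 3) : Set where
  field
    col        : Fin r → Fin r → Fin 3
    col-sym    : ∀ i j → adj G i j ≡ true → col i j ≡ col j i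
    pendant-ok : ∀ i j → adj G i j ≡ true → col i j ≢ p i
    edges-ok   : ∀ i j k → adj G i j ≡ true → adj G i k ≡ true → j ≢ k →
                 col i j ≢ col i k

CycleAdj : ∀ {r} → Fin r → Fin r → Set
CycleAdj {r} a b =
  (suc (toℕ a) ≡ toℕ b) ⊎ (suc (toℕ b) ≡ toℕ a) ⊎
  (toℕ a ≡ 0 × suc (toℕ b) ≡ r) ⊎ (toℕ b ≡ 0 × suc (toℕ a) ≡ r)

IsSpanningCycle : ∀ {r} → SimpleGraph r → Set
IsSpanningCycle {r} G =
  Σ (Permutation′ r) λ π → ∀ a b →
    (adj G (π ⟨$⟩ʳ a) (π ⟨$⟩ʳ b) ≡ true → CycleAdj a b) ×
    (CycleAdj a b → adj G (π ⟨$⟩ʳ a) (π ⟨$⟩ʳ b) ≡ true)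

{-# OPTIONS --safe #-}
-- At a vertex of a 2-regular graph the two graph edges carry exactly the two colours other
-- than the pendant colour, so colour k occurs at r − x_k edge-ends; every edge has two ends,
-- hence r − x_k is even.  Conversely, when x₁, x₂, x₃ share the parity of r, start from a
-- properly coloured triangle (all odd) or 4-cycle (all even) and repeatedly splice two new
-- vertices of one pendant colour c into an edge not coloured c; a colour-preserving
-- relabelling of the vertices moves the result onto the given pendant colouring.  On an even
-- cycle whose pendant edges all have colour c the two other colours simply alternate.
module Submission where

open import Defs hiding (sym)

open import Data.Bool using (Bool; true; false; not; _∧_; _∨_; if_then_else_)
import Data.Bool as Bool
open import Data.Bool.Properties using (∨-comm; ∨-zeroʳ)
open import Data.Empty using (⊥-elim)
open import Data.Fin using (Fin; zero; suc; toℕ; punchIn)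
open import Data.Fin.Patterns using (0F; 1F; 2F; 3F)
open import Data.Fin.Permutation using (_⟨$⟩ʳ_; _⟨$⟩ˡ_; inverseʳ)
open import Data.Fin.Properties
  using (_≟_; all?; any?; suc-injective; toℕ-injective; toℕ<n; punchIn-injective; punchInᵢ≢i)
open import Data.List using (length; filter; tabulate)
open import Data.Nat using (ℕ; zero; suc; parity; _+_; _*_; _%_; _/_; _≤_; _<_; z≤n; s≤s)
open import Data.Nat.DivMod using ([m+kn]%n≡m%n; m≡m%n+[m/n]*n; m%n<n)
open import Data.Nat.Properties
  using (+-0-commutativeMonoid; +-identityʳ; +-comm; +-suc; +-monoʳ-<; <-irrefl; ≤-trans; ≤-reflexive;
         m≢1+n+m)
  renaming (_≟_ to _≟ℕ_; suc-injective to ℕ-suc-injective)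
open import Data.Nat.Tactic.RingSolver using (solve-∀)
open import Data.Parity.Base using (Parity; 0ℙ; 1ℙ)
open import Data.Parity.Properties using (p≢p⁻¹; suc-homo-⁻¹)
open import Data.Product using (∃-syntax; ∃₂; Σ; Σ-syntax; _×_; _,_; proj₁; proj₂)
open import Data.Sum using (_⊎_; inj₁; inj₂; [_,_])
open import Data.Vec.Functional using (_∷_; [])
open import Function using (_∘_; id)
open import Function.Bundles using (Inverse; _↔_; _⇔_; mk↔ₛ′; mk⇔)
open import Relation.Binary.PropositionalEquality
  using (_≡_; _≢_; refl; sym; trans; cong; cong₂; subst; subst₂; module ≡-Reasoning)
open import Relation.Nullary using (Dec; does; ¬_; ¬?; yes; no)
open import Relation.Nullary.Decidable
  using (True; toWitness; _→-dec_; _×-dec_; _⊎-dec_; dec-true; dec-false)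
open import Relation.Unary using (Pred; Decidable)

open import Algebra.Properties.CommutativeMonoid.Sum +-0-commutativeMonoid
  using (sum; sum-cong-≗; sum-replicate-zero; ∑-distrib-+)

-- Counting over Fin n

indicator : Bool → ℕ
indicator false = 0
indicator true  = 1

count : ∀ {n} → (Fin n → Bool) → ℕ
count f = sum (indicator ∘ f)

length-filter-tabulate : ∀ {a p} {A : Set a} {P : Pred A p} (P? : Decidable P) {n} (g : Fin n → A) →
  length (filter P? (tabulate g)) ≡ count (λ i → does (P? (g i)))
length-filter-tabulate P? {zero} g = refl
length-filter-tabulate P? {suc n} g with does (P? (g zero))
... | true  = cong suc (length-filter-tabulate P? (g ∘ suc))
... | false = length-filter-tabulate P? (g ∘ suc)

sum-zero : ∀ {n} (g : Fin n → ℕ) → (∀ i → g i ≡ 0) → sum g ≡ 0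
sum-zero {n} g vanish = trans (sum-cong-≗ vanish) (sum-replicate-zero n)

sum-single-support : ∀ {n} (g : Fin n → ℕ) {j} → (∀ i → i ≢ j → g i ≡ 0) → sum g ≡ g j
sum-single-support g {zero} vanish = begin
  g zero + sum (g ∘ suc) ≡⟨ cong (g zero +_) (sum-zero (g ∘ suc) λ i → vanish (suc i) λ ()) ⟩
  g zero + 0             ≡⟨ +-identityʳ (g zero) ⟩
  g zero                 ∎
  where open ≡-Reasoning
sum-single-support g {suc j} vanish =
  cong₂ _+_ (vanish zero λ ())
            (sum-single-support (g ∘ suc) λ i i≢j → vanish (suc i) (i≢j ∘ suc-injective))

sum-pair-support : ∀ {n} (g : Fin n → ℕ) {j l} → j ≢ l → (∀ i → i ≢ j → i ≢ l → g i ≡ 0) →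
  sum g ≡ g j + g l
sum-pair-support g {zero} {zero} j≢l _ = ⊥-elim (j≢l refl)
sum-pair-support g {zero} {suc l} _ vanish =
  cong (g zero +_) (sum-single-support (g ∘ suc) λ i i≢l → vanish (suc i) (λ ()) (i≢l ∘ suc-injective))
sum-pair-support g {suc j} {zero} _ vanish =
  trans (cong (g zero +_) (sum-single-support (g ∘ suc) λ i i≢j →
                             vanish (suc i) (i≢j ∘ suc-injective) (λ ())))
        (+-comm (g zero) (g (suc j)))
sum-pair-support g {suc j} {suc l} j≢l vanish =
  cong₂ _+_ (vanish zero (λ ()) (λ ()))
            (sum-pair-support (g ∘ suc) (j≢l ∘ cong suc) λ i i≢j i≢l →
               vanish (suc i) (i≢j ∘ suc-injective) (i≢l ∘ suc-injective))

sum-symmetric-even : ∀ {n} (e : Fin n → Fin n → ℕ) → (∀ i j → e i j ≡ e j i) → (∀ i → e i i ≡ 0) →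
  ∃[ m ] sum (λ i → sum (e i)) ≡ m * 2
sum-symmetric-even {zero} e _ _ = 0 , refl
sum-symmetric-even {suc n} e e-sym e-diag
  with m , eq ← sum-symmetric-even (λ i j → e (suc i) (suc j))
                  (λ i j → e-sym (suc i) (suc j)) (e-diag ∘ suc)
  = row + m , (begin
    e zero zero + row + sum (λ i → e (suc i) zero + sum (λ j → e (suc i) (suc j)))
      ≡⟨ cong₂ _+_ (cong (_+ row) (e-diag zero)) (∑-distrib-+ (λ i → e (suc i) zero) _) ⟩
    row + (sum (λ i → e (suc i) zero) + sum (λ i → sum (λ j → e (suc i) (suc j))))
      ≡⟨ cong₂ (λ a b → row + (a + b)) (sum-cong-≗ λ i → e-sym (suc i) zero) eq ⟩
    row + (row + m * 2)
      ≡⟨ rearrange row m ⟩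
    (row + m) * 2 ∎)
  where
  open ≡-Reasoning
  row : ℕ
  row = sum (λ j → e zero (suc j))

  rearrange : ∀ a b → a + (a + b * 2) ≡ (a + b) * 2
  rearrange = solve-∀

count-complement : ∀ {n} (f : Fin n → Bool) → count f + count (not ∘ f) ≡ n
count-complement {zero} f = refl
count-complement {suc n} f with f zero | count-complement (f ∘ suc)
... | true  | ih = cong suc ih
... | false | ih = trans (+-suc (count (f ∘ suc)) _) (cong suc ih)

count≡0⇒false : ∀ {n} (f : Fin n → Bool) → count f ≡ 0 → ∀ i → f i ≡ false
count≡0⇒false f h zero with f zero
... | false = refl
count≡0⇒false f h (suc i) with f zero
... | false = count≡0⇒false (f ∘ suc) h i

count≡1⇒unique : ∀ {n} (f : Fin n → Bool) → count f ≡ 1 →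
  ∃[ j ] f j ≡ true × (∀ i → f i ≡ true → i ≡ j)
count≡1⇒unique {suc n} f h with f zero in f₀
... | true = zero , f₀ , only-zero
  where
  only-zero : ∀ i → f i ≡ true → i ≡ zero
  only-zero zero    _  = refl
  only-zero (suc i) fi with () ← trans (sym fi) (count≡0⇒false (f ∘ suc) (ℕ-suc-injective h) i)
... | false with j , fj , only ← count≡1⇒unique (f ∘ suc) h = suc j , fj , only-suc
  where
  only-suc : ∀ i → f i ≡ true → i ≡ suc j
  only-suc zero    fi with () ← trans (sym f₀) fi
  only-suc (suc i) fi = cong suc (only i fi)

count≡2⇒pair : ∀ {n} (f : Fin n → Bool) → count f ≡ 2 →
  ∃₂ λ j l → j ≢ l × f j ≡ true × f l ≡ true × (∀ i → f i ≡ true → i ≡ j ⊎ i ≡ l)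
count≡2⇒pair {suc n} f h with f zero in f₀
... | true with l , fl , only ← count≡1⇒unique (f ∘ suc) (ℕ-suc-injective h) =
  zero , suc l , (λ ()) , f₀ , fl , λ { zero _ → inj₁ refl ; (suc i) fi → inj₂ (cong suc (only i fi)) }
... | false with j , l , j≢l , fj , fl , only ← count≡2⇒pair (f ∘ suc) h =
  suc j , suc l , j≢l ∘ suc-injective , fj , fl , only-suc
  where
  only-suc : ∀ i → f i ≡ true → i ≡ suc j ⊎ i ≡ suc l
  only-suc zero    fi with () ← trans (sym f₀) fi
  only-suc (suc i) fi = Data.Sum.map (cong suc) (cong suc) (only i fi)

-- Parity of the colour classes

colourClass : ∀ {n m} → (Fin n → Fin m) → Fin m → Fin n → Bool
colourClass τ c v = does (τ v ≟ c)

colourCount-count : ∀ {r} (p : Fin r → Fin 3) k → colourCount p k ≡ count (colourClass p k)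
colourCount-count p k = length-filter-tabulate (λ i → p i ≟ k) id

degree-count : ∀ {r} (G : SimpleGraph r) i → degree G i ≡ count (adj G i)
degree-count G i = trans (length-filter-tabulate (λ j → adj G i j Bool.≟ true) id)
                         (sum-cong-≗ λ j → cong indicator (does-≟-true (adj G i j)))
  where
  does-≟-true : ∀ b → does (b Bool.≟ true) ≡ b
  does-≟-true false = refl
  does-≟-true true  = refl

other-two-colours : ∀ (a b c k : Fin 3) → b ≢ a → c ≢ a → b ≢ c →
  indicator (does (b ≟ k)) + indicator (does (c ≟ k)) ≡ indicator (not (does (a ≟ k)))
other-two-colours = toWitness {a? = all? λ a → all? λ b → all? λ c → all? λ k →
  ¬? (b ≟ a) →-dec ¬? (c ≟ a) →-dec ¬? (b ≟ c) →-dec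
  (indicator (does (b ≟ k)) + indicator (does (c ≟ k)) ≟ℕ indicator (not (does (a ≟ k))))} _

module _ {r} {G : SimpleGraph r} {p : Fin r → Fin 3} (E : ProperExtension G p) (k : Fin 3) where
  open ProperExtension E

  edgeOfColour : Fin r → Fin r → ℕ
  edgeOfColour i j = indicator (adj G i j ∧ does (col i j ≟ k))

  edgeOfColour-sym : ∀ i j → edgeOfColour i j ≡ edgeOfColour j i
  edgeOfColour-sym i j with adj G i j in ij | adj G j i in ji
  ... | true  | true  = cong (λ c → indicator (does (c ≟ k))) (col-sym i j ij)
  ... | false | false = refl
  ... | true  | false with () ← trans (sym ij) (trans (SimpleGraph.sym G i j) ji)
  ... | false | true  with () ← trans (sym ij) (trans (SimpleGraph.sym G i j) ji)

  edgeOfColour-diag : ∀ i → edgeOfColour i i ≡ 0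
  edgeOfColour-diag i rewrite irrefl G i = refl

  edgesOfColour-at-vertex : ∀ i → degree G i ≡ 2 →
    sum (edgeOfColour i) ≡ indicator (not (colourClass p k i))
  edgesOfColour-at-vertex i deg
    with j , l , j≢l , ij , il , only ← count≡2⇒pair (adj G i) (trans (sym (degree-count G i)) deg) = begin
    sum (edgeOfColour i)
      ≡⟨ sum-pair-support (edgeOfColour i) j≢l non-neighbour ⟩
    edgeOfColour i j + edgeOfColour i l
      ≡⟨ cong₂ (λ a b → indicator (a ∧ does (col i j ≟ k)) + indicator (b ∧ does (col i l ≟ k))) ij il ⟩
    indicator (does (col i j ≟ k)) + indicator (does (col i l ≟ k))
      ≡⟨ other-two-colours (p i) (col i j) (col i l) k
           (pendant-ok i j ij) (pendant-ok i l il) (edges-ok i j l ij il j≢l) ⟩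
    indicator (not (colourClass p k i)) ∎
    where
    open ≡-Reasoning
    non-neighbour : ∀ m → m ≢ j → m ≢ l → edgeOfColour i m ≡ 0
    non-neighbour m m≢j m≢l with adj G i m in im
    ... | false = refl
    ... | true  = ⊥-elim ([ m≢j , m≢l ] (only m im))

colourCount-parity : ∀ {r} {G : SimpleGraph r} {p : Fin r → Fin 3} → TwoRegular G → ProperExtension G p →
  ∀ k → colourCount p k % 2 ≡ r % 2
colourCount-parity {r} {G} {p} regular E k
  with m , even ← sum-symmetric-even (edgeOfColour E k) (edgeOfColour-sym E k) (edgeOfColour-diag E k) =
  begin
    colourCount p k % 2                 ≡⟨ cong (_% 2) (colourCount-count p k) ⟩
    count class % 2                     ≡⟨ sym ([m+kn]%n≡m%n (count class) m 2) ⟩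
    (count class + m * 2) % 2           ≡⟨ cong (λ s → (count class + s) % 2) (sym even) ⟩
    (count class + sum (λ i → sum (edgeOfColour E k i))) % 2
      ≡⟨ cong (λ s → (count class + s) % 2) (sum-cong-≗ λ i → edgesOfColour-at-vertex E k i (regular i)) ⟩
    (count class + count (not ∘ class)) % 2 ≡⟨ cong (_% 2) (count-complement class) ⟩
    r % 2 ∎
  where
  open ≡-Reasoning
  class : Fin r → Bool
  class = colourClass p k

-- Coloured 2-factors

-- next is a permutation without fixed points or 2-cycles, i.e. an orientation of a 2-regular
-- simple graph, and colour v is the colour of the edge from v to next v.
record CyclicColouring {n} (τ : Fin n → Fin 3) : Set where
  field
    next prev           : Fin n → Fin n
    prev-next           : ∀ v → prev (next v) ≡ v
    next-prev           : ∀ v → next (prev v) ≡ v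
    next≢id             : ∀ v → next v ≢ v
    next²≢id            : ∀ v → next (next v) ≢ v
    colour              : Fin n → Fin 3
    colour≢pendant      : ∀ v → colour v ≢ τ v
    colour≢pendant-next : ∀ v → colour v ≢ τ (next v)
    colour≢colour-next  : ∀ v → colour v ≢ colour (next v)

  next-injective : ∀ {v w} → next v ≡ next w → v ≡ w
  next-injective {v} {w} e = trans (sym (prev-next v)) (trans (cong prev e) (prev-next w))

  next≢prev : ∀ v → next v ≢ prev v
  next≢prev v e = next²≢id v (trans (cong next e) (next-prev v))

  colour-avoiding : Fin n → ∀ c → ∃[ u ] colour u ≢ c
  colour-avoiding v c with colour v ≟ c
  ... | no  colour-v≢c = v , colour-v≢c
  ... | yes colour-v≡c = prev v , λ e →
    colour≢colour-next (prev v) (trans e (trans (sym colour-v≡c) (cong colour (sym (next-prev v)))))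

  colour≢colour-prev : ∀ {v w} → next w ≡ v → colour v ≢ colour w
  colour≢colour-prev {w = w} e q = colour≢colour-next w (trans (sym q) (cong colour (sym e)))

module _ {n} {τ : Fin n → Fin 3} (C : CyclicColouring τ) where
  open CyclicColouring C

  cycleAdj : Fin n → Fin n → Bool
  cycleAdj i j = does (next i ≟ j) ∨ does (next j ≟ i)

  cycleAdj-irrefl : ∀ i → cycleAdj i i ≡ false
  cycleAdj-irrefl i rewrite dec-false (next i ≟ i) (next≢id i) = refl

  cycleGraph : SimpleGraph n
  cycleGraph = record
    { adj = cycleAdj
    ; sym = λ i j → ∨-comm (does (next i ≟ j)) (does (next j ≟ i))
    ; irrefl = cycleAdj-irrefl
    }

  cycleAdj-cases : ∀ {i j} → cycleAdj i j ≡ true → next i ≡ j ⊎ next j ≡ i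
  cycleAdj-cases {i} {j} ij with next i ≟ j | next j ≟ i
  ... | yes e | _     = inj₁ e
  ... | no _  | yes e = inj₂ e

  cycleAdj-next : ∀ i → cycleAdj i (next i) ≡ true
  cycleAdj-next i rewrite dec-true (next i ≟ next i) refl = refl

  cycleAdj-prev : ∀ i → cycleAdj i (prev i) ≡ true
  cycleAdj-prev i rewrite dec-true (next (prev i) ≟ i) (next-prev i) = ∨-zeroʳ _

  cycleGraph-regular : TwoRegular cycleGraph
  cycleGraph-regular i = begin
    degree cycleGraph i
      ≡⟨ degree-count cycleGraph i ⟩
    sum (indicator ∘ cycleAdj i)
      ≡⟨ sum-pair-support _ (next≢prev i) non-neighbour ⟩
    indicator (cycleAdj i (next i)) + indicator (cycleAdj i (prev i))
      ≡⟨ cong₂ (λ a b → indicator a + indicator b) (cycleAdj-next i) (cycleAdj-prev i) ⟩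
    2 ∎
    where
    open ≡-Reasoning
    non-neighbour : ∀ m → m ≢ next i → m ≢ prev i → indicator (cycleAdj i m) ≡ 0
    non-neighbour m m≢next m≢prev with cycleAdj i m in im
    ... | false = refl
    ... | true with cycleAdj-cases im
    ...   | inj₁ e = ⊥-elim (m≢next (sym e))
    ...   | inj₂ e = ⊥-elim (m≢prev (trans (sym (prev-next m)) (cong prev e)))

  edgeColour : Fin n → Fin n → Fin 3
  edgeColour i j = if does (next i ≟ j) then colour i else colour j

  edgeColour-forward : ∀ {i j} → next i ≡ j → edgeColour i j ≡ colour i
  edgeColour-forward {i} {j} e rewrite dec-true (next i ≟ j) e = refl

  edgeColour-backward : ∀ {i j} → next j ≡ i → edgeColour i j ≡ colour j
  edgeColour-backward {i} {j} e
    rewrite dec-false (next i ≟ j) (λ e′ → next²≢id j (trans (cong next e) e′)) = refl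

  cycleExtension : ProperExtension cycleGraph τ
  cycleExtension = record
    { col = edgeColour ; col-sym = col-sym ; pendant-ok = pendant-ok ; edges-ok = edges-ok }
    where
    col-sym : ∀ i j → cycleAdj i j ≡ true → edgeColour i j ≡ edgeColour j i
    col-sym i j ij with cycleAdj-cases ij
    ... | inj₁ e = trans (edgeColour-forward e) (sym (edgeColour-backward e))
    ... | inj₂ e = trans (edgeColour-backward e) (sym (edgeColour-forward e))

    pendant-ok : ∀ i j → cycleAdj i j ≡ true → edgeColour i j ≢ τ i
    pendant-ok i j ij with cycleAdj-cases ij
    ... | inj₁ e = subst (_≢ τ i) (sym (edgeColour-forward e)) (colour≢pendant i)
    ... | inj₂ e = subst₂ _≢_ (sym (edgeColour-backward e)) (cong τ e) (colour≢pendant-next j)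

    edges-ok : ∀ i j l → cycleAdj i j ≡ true → cycleAdj i l ≡ true → j ≢ l → edgeColour i j ≢ edgeColour i l
    edges-ok i j l ij il j≢l with cycleAdj-cases ij | cycleAdj-cases il
    ... | inj₁ e | inj₁ e′ = ⊥-elim (j≢l (trans (sym e) e′))
    ... | inj₂ e | inj₂ e′ = ⊥-elim (j≢l (next-injective (trans e (sym e′))))
    ... | inj₁ e | inj₂ e′ =
      subst₂ _≢_ (sym (edgeColour-forward e)) (sym (edgeColour-backward e′)) (colour≢colour-prev e′)
    ... | inj₂ e | inj₁ e′ =
      subst₂ _≢_ (sym (edgeColour-backward e)) (sym (edgeColour-forward e′)) (colour≢colour-prev e ∘ sym)

-- Relabelling along colour classes

rank : ∀ {n} → (Fin n → Bool) → Fin n → ℕ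
rank f zero    = 0
rank f (suc i) = indicator (f zero) + rank (f ∘ suc) i

rank<count : ∀ {n} (f : Fin n → Bool) {i} → f i ≡ true → rank f i < count f
rank<count f {zero}  fi rewrite fi = s≤s z≤n
rank<count f {suc i} fi = +-monoʳ-< (indicator (f zero)) (rank<count (f ∘ suc) fi)

rank-injective : ∀ {n} (f : Fin n → Bool) {i j} → f i ≡ true → f j ≡ true → rank f i ≡ rank f j → i ≡ j
rank-injective f {zero}  {zero}  _  _  _ = refl
rank-injective f {zero}  {suc j} fi _  e rewrite fi with () ← e
rank-injective f {suc i} {zero}  _  fj e rewrite fj with () ← e
rank-injective f {suc i} {suc j} fi fj e with f zero
... | true  = cong suc (rank-injective (f ∘ suc) fi fj (ℕ-suc-injective e))
... | false = cong suc (rank-injective (f ∘ suc) fi fj e)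

select : ∀ {n} (f : Fin n → Bool) {k} → k < count f → ∃[ i ] f i ≡ true × rank f i ≡ k
select {suc n} f {k} k<count with f zero in f₀
select f {zero}  _           | true = zero , f₀ , refl
select f {suc k} (s≤s k<count) | true with i , fi , rank≡k ← select (f ∘ suc) k<count =
  suc i , fi , trans (cong (λ b → indicator b + rank (f ∘ suc) i) f₀) (cong suc rank≡k)
select f {k} k<count | false with i , fi , rank≡k ← select (f ∘ suc) k<count =
  suc i , fi , trans (cong (λ b → indicator b + rank (f ∘ suc) i) f₀) rank≡k

≟-true⇒≡ : ∀ {m} {a b : Fin m} → does (a ≟ b) ≡ true → a ≡ b
≟-true⇒≡ {a = a} {b} e with a ≟ b
... | yes a≡b = a≡b

module Matching {r n m} (p : Fin r → Fin m) (τ : Fin n → Fin m)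
                (same : ∀ c → count (colourClass p c) ≡ count (colourClass τ c)) where

  private
    -- v goes to the vertex of τ's class of colour p v that has the same rank there as v in p's.
    partner : ∀ v → ∃[ w ] colourClass τ (p v) w ≡ true ×
                           rank (colourClass τ (p v)) w ≡ rank (colourClass p (p v)) v
    partner v = select (colourClass τ (p v))
      (subst (rank (colourClass p (p v)) v <_) (same (p v))
             (rank<count (colourClass p (p v)) (dec-true (p v ≟ p v) refl)))

  to : Fin r → Fin n
  to v = proj₁ (partner v)

  to-colour : ∀ v → τ (to v) ≡ p v
  to-colour v = ≟-true⇒≡ (proj₁ (proj₂ (partner v)))

  to-rank : ∀ v → rank (colourClass τ (p v)) (to v) ≡ rank (colourClass p (p v)) v
  to-rank v = proj₂ (proj₂ (partner v))

matching-retraction : ∀ {r n m} (p : Fin r → Fin m) (τ : Fin n → Fin m) same same′ v →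
  Matching.to τ p same′ (Matching.to p τ same v) ≡ v
matching-retraction {r} {n} p τ same same′ v =
  rank-injective (colourClass p (p v)) (dec-true (p v′ ≟ p v) p-v′) (dec-true (p v ≟ p v) refl)
    (trans (subst (λ c → rank (colourClass p c) v′ ≡ rank (colourClass τ c) w) (to-colour v) (from-rank w))
           (to-rank v))
  where
  open Matching p τ same
  open Matching τ p same′ using () renaming (to to from; to-colour to from-colour; to-rank to from-rank)
  w : Fin n
  w = to v

  v′ : Fin r
  v′ = from w

  p-v′ : p v′ ≡ p v
  p-v′ = trans (from-colour w) (to-colour v)

colourMatching : ∀ {r n m} (p : Fin r → Fin m) (τ : Fin n → Fin m) →
  (∀ c → count (colourClass p c) ≡ count (colourClass τ c)) →
  Σ[ π ∈ Fin r ↔ Fin n ] (∀ v → τ (Inverse.to π v) ≡ p v)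
colourMatching p τ same =
  mk↔ₛ′ (Matching.to p τ same) (Matching.to τ p same′)
        (matching-retraction τ p same′ same) (matching-retraction p τ same same′) ,
  Matching.to-colour p τ same
  where
  same′ : ∀ c → count (colourClass τ c) ≡ count (colourClass p c)
  same′ c = sym (same c)

transport : ∀ {r n} {p : Fin r → Fin 3} {τ : Fin n → Fin 3} (π : Fin r ↔ Fin n) →
  (∀ v → τ (Inverse.to π v) ≡ p v) → CyclicColouring τ → CyclicColouring p
transport {p = p} {τ} π preserves C = record
  { next                = from ∘ next ∘ to
  ; prev                = from ∘ prev ∘ to
  ; prev-next           = λ v → conjugate-inverse prev next (prev-next (to v))
  ; next-prev           = λ v → conjugate-inverse next prev (next-prev (to v))
  ; next≢id             = λ v e → next≢id (to v) (trans (sym (to-from _)) (cong to e))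
  ; next²≢id            = λ v e → next²≢id (to v)
                                    (trans (cong next (sym (to-from _))) (trans (sym (to-from _)) (cong to e)))
  ; colour              = colour ∘ to
  ; colour≢pendant      = λ v → subst (colour (to v) ≢_) (preserves v) (colour≢pendant (to v))
  ; colour≢pendant-next = λ v → subst (colour (to v) ≢_) (sym (p-from _)) (colour≢pendant-next (to v))
  ; colour≢colour-next  = λ v → subst (λ w → colour (to v) ≢ colour w) (sym (to-from _))
                                        (colour≢colour-next (to v))
  }
  where
  open CyclicColouring C
  open Inverse π using (to; from) renaming (strictlyInverseˡ to to-from; strictlyInverseʳ to from-to)

  conjugate-inverse : ∀ f g {v} → f (g (to v)) ≡ to v → from (f (to (from (g (to v))))) ≡ v
  conjugate-inverse f g {v} e = trans (cong (from ∘ f) (to-from _)) (trans (cong from e) (from-to v))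

  p-from : ∀ w → p (from w) ≡ τ w
  p-from w = trans (sym (preserves (from w))) (cong τ (to-from w))

-- Building coloured 2-factors

avoid-two : ∀ (a c : Fin 3) → ∃[ b ] b ≢ a × b ≢ c
avoid-two = toWitness {a? = all? λ a → all? λ c → any? λ b → ¬? (b ≟ a) ×-dec ¬? (b ≟ c)} _

-- The new vertices 0F and 1F, of pendant colour c, are spliced into the edge u → next u; its
-- colour a ≠ c stays on both outer edges and the middle edge gets a third colour b.
module InsertPair {n} {τ : Fin n → Fin 3} (C : CyclicColouring τ)
                  (c : Fin 3) (u : Fin n) (a≢c : CyclicColouring.colour C u ≢ c) where
  open CyclicColouring C

  a : Fin 3
  a = colour u

  b : Fin 3
  b = proj₁ (avoid-two a c)

  b≢a : b ≢ a
  b≢a = proj₁ (proj₂ (avoid-two a c))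

  b≢c : b ≢ c
  b≢c = proj₂ (proj₂ (avoid-two a c))

  next′ : Fin (suc (suc n)) → Fin (suc (suc n))
  next′ 0F = 1F
  next′ 1F = suc (suc (next u))
  next′ (suc (suc v)) with v ≟ u
  ... | yes _ = 0F
  ... | no  _ = suc (suc (next v))

  prev′ : Fin (suc (suc n)) → Fin (suc (suc n))
  prev′ 0F = suc (suc u)
  prev′ 1F = 0F
  prev′ (suc (suc v)) with v ≟ next u
  ... | yes _ = 1F
  ... | no  _ = suc (suc (prev v))

  colour′ : Fin (suc (suc n)) → Fin 3
  colour′ 0F = b
  colour′ 1F = a
  colour′ (suc (suc v)) = colour v

  prev′-next′ : ∀ v → prev′ (next′ v) ≡ v
  prev′-next′ 0F = refl
  prev′-next′ 1F with next u ≟ next u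
  ... | yes _ = refl
  ... | no ≢  = ⊥-elim (≢ refl)
  prev′-next′ (suc (suc v)) with v ≟ u
  ... | yes refl = refl
  ... | no v≢u with next v ≟ next u
  ...   | yes e = ⊥-elim (v≢u (next-injective e))
  ...   | no  _ = cong (λ w → suc (suc w)) (prev-next v)

  next′-prev′ : ∀ v → next′ (prev′ v) ≡ v
  next′-prev′ 0F with u ≟ u
  ... | yes _ = refl
  ... | no ≢  = ⊥-elim (≢ refl)
  next′-prev′ 1F = refl
  next′-prev′ (suc (suc v)) with v ≟ next u
  ... | yes refl = refl
  ... | no v≢next-u with prev v ≟ u
  ...   | yes e = ⊥-elim (v≢next-u (trans (sym (next-prev v)) (cong next e)))
  ...   | no  _ = cong (λ w → suc (suc w)) (next-prev v)

  next′≢id : ∀ v → next′ v ≢ v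
  next′≢id 0F = λ ()
  next′≢id 1F = λ ()
  next′≢id (suc (suc v)) with v ≟ u
  ... | yes _ = λ ()
  ... | no  _ = next≢id v ∘ suc-injective ∘ suc-injective

  next′²≢id : ∀ v → next′ (next′ v) ≢ v
  next′²≢id 0F = λ ()
  next′²≢id 1F with next u ≟ u
  ... | yes _ = λ ()
  ... | no  _ = λ ()
  next′²≢id (suc (suc v)) with v ≟ u
  ... | yes _ = λ ()
  ... | no  _ with next v ≟ u
  ...   | yes _ = λ ()
  ...   | no  _ = next²≢id v ∘ suc-injective ∘ suc-injective

  colour′≢pendant : ∀ v → colour′ v ≢ (c ∷ c ∷ τ) v
  colour′≢pendant 0F = b≢c
  colour′≢pendant 1F = a≢c
  colour′≢pendant (suc (suc v)) = colour≢pendant v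

  colour′≢pendant-next : ∀ v → colour′ v ≢ (c ∷ c ∷ τ) (next′ v)
  colour′≢pendant-next 0F = b≢c
  colour′≢pendant-next 1F = colour≢pendant-next u
  colour′≢pendant-next (suc (suc v)) with v ≟ u
  ... | yes refl = a≢c
  ... | no  _    = colour≢pendant-next v

  colour′≢colour-next : ∀ v → colour′ v ≢ colour′ (next′ v)
  colour′≢colour-next 0F = b≢a
  colour′≢colour-next 1F = colour≢colour-next u
  colour′≢colour-next (suc (suc v)) with v ≟ u
  ... | yes refl = b≢a ∘ sym
  ... | no  _    = colour≢colour-next v

  result : CyclicColouring (c ∷ c ∷ τ)
  result = record
    { next = next′ ; prev = prev′ ; prev-next = prev′-next′ ; next-prev = next′-prev′
    ; next≢id = next′≢id ; next²≢id = next′²≢id ; colour = colour′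
    ; colour≢pendant = colour′≢pendant ; colour≢pendant-next = colour′≢pendant-next
    ; colour≢colour-next = colour′≢colour-next
    }

insertPair : ∀ {n} {τ : Fin (suc n) → Fin 3} → CyclicColouring τ → (c : Fin 3) → CyclicColouring (c ∷ c ∷ τ)
insertPair C c with u , colour-u≢c ← CyclicColouring.colour-avoiding C 0F c =
  InsertPair.result C c u colour-u≢c

-- The vertex set is kept nonempty, so that insertPair always finds an edge to split.
Realisable : ℕ → ℕ → ℕ → Set
Realisable x y z = Σ[ n ∈ ℕ ] Σ[ τ ∈ (Fin (suc n) → Fin 3) ]
  CyclicColouring τ × (∀ c → count (colourClass τ c) ≡ (x ∷ y ∷ z ∷ []) c)

realisable-cong : ∀ {x y z x′ y′ z′} → x ≡ x′ → y ≡ y′ → z ≡ z′ → Realisable x y z → Realisable x′ y′ z′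
realisable-cong refl refl refl R = R

grow₀ : ∀ {x y z} → Realisable x y z → Realisable (2 + x) y z
grow₀ (n , τ , C , sizes) =
  2 + n , 0F ∷ 0F ∷ τ , insertPair C 0F , λ { 0F → cong (2 +_) (sizes 0F) ; 1F → sizes 1F ; 2F → sizes 2F }

grow₁ : ∀ {x y z} → Realisable x y z → Realisable x (2 + y) z
grow₁ (n , τ , C , sizes) =
  2 + n , 1F ∷ 1F ∷ τ , insertPair C 1F , λ { 0F → sizes 0F ; 1F → cong (2 +_) (sizes 1F) ; 2F → sizes 2F }

grow₂ : ∀ {x y z} → Realisable x y z → Realisable x y (2 + z)
grow₂ (n , τ , C , sizes) =
  2 + n , 2F ∷ 2F ∷ τ , insertPair C 2F , λ { 0F → sizes 0F ; 1F → sizes 1F ; 2F → cong (2 +_) (sizes 2F) }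

2+[m+n]≡m+[2+n] : ∀ m n → 2 + (m + n) ≡ m + (2 + n)
2+[m+n]≡m+[2+n] = solve-∀

addPairs : ∀ a b c {x y z} → Realisable x y z → Realisable (x + a * 2) (y + b * 2) (z + c * 2)
addPairs (suc a) b c {x} R =
  realisable-cong (2+[m+n]≡m+[2+n] x (a * 2)) refl refl (grow₀ (addPairs a b c R))
addPairs zero (suc b) c {y = y} R =
  realisable-cong refl (2+[m+n]≡m+[2+n] y (b * 2)) refl (grow₁ (addPairs 0 b c R))
addPairs zero zero (suc c) {z = z} R =
  realisable-cong refl refl (2+[m+n]≡m+[2+n] z (c * 2)) (grow₂ (addPairs 0 0 c R))
addPairs zero zero zero {x} {y} {z} R =
  realisable-cong (sym (+-identityʳ x)) (sym (+-identityʳ y)) (sym (+-identityʳ z)) R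

byComputation : ∀ {n} (τ : Fin (suc n) → Fin 3) (next prev : Fin (suc n) → Fin (suc n))
  (colour : Fin (suc n) → Fin 3) {x y z} →
  {_ : True (all? λ v → prev (next v) ≟ v)} →
  {_ : True (all? λ v → next (prev v) ≟ v)} →
  {_ : True (all? λ v → ¬? (next v ≟ v))} →
  {_ : True (all? λ v → ¬? (next (next v) ≟ v))} →
  {_ : True (all? λ v → ¬? (colour v ≟ τ v))} →
  {_ : True (all? λ v → ¬? (colour v ≟ τ (next v)))} →
  {_ : True (all? λ v → ¬? (colour v ≟ colour (next v)))} →
  {_ : True (all? λ c → count (colourClass τ c) ≟ℕ (x ∷ y ∷ z ∷ []) c)} →
  Realisable x y z
byComputation {n} τ next prev colour {_} {_} {_} {c₁} {c₂} {c₃} {c₄} {c₅} {c₆} {c₇} {c₈} =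
  n , τ , C , toWitness c₈
  where
  C : CyclicColouring τ
  C = record
    { next = next ; prev = prev ; prev-next = toWitness c₁ ; next-prev = toWitness c₂
    ; next≢id = toWitness c₃ ; next²≢id = toWitness c₄ ; colour = colour
    ; colour≢pendant = toWitness c₅ ; colour≢pendant-next = toWitness c₆
    ; colour≢colour-next = toWitness c₇
    }

triangle : Realisable 1 1 1
triangle = byComputation (0F ∷ 1F ∷ 2F ∷ []) (1F ∷ 2F ∷ 0F ∷ []) (2F ∷ 0F ∷ 1F ∷ []) (2F ∷ 0F ∷ 1F ∷ [])

rotate₄ rotate₄⁻¹ : Fin 4 → Fin 4
rotate₄   = 1F ∷ 2F ∷ 3F ∷ 0F ∷ []
rotate₄⁻¹ = 3F ∷ 0F ∷ 1F ∷ 2F ∷ []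

evenRealisable : ∀ a b c → 3 ≤ a * 2 + b * 2 + c * 2 → Realisable (a * 2) (b * 2) (c * 2)
evenRealisable (suc a) (suc b) c _ =
  addPairs a b c (byComputation (0F ∷ 0F ∷ 1F ∷ 1F ∷ []) rotate₄ rotate₄⁻¹ (1F ∷ 2F ∷ 0F ∷ 2F ∷ []))
evenRealisable (suc a) zero (suc c) _ =
  addPairs a 0 c (byComputation (0F ∷ 0F ∷ 2F ∷ 2F ∷ []) rotate₄ rotate₄⁻¹ (2F ∷ 1F ∷ 0F ∷ 1F ∷ []))
evenRealisable zero (suc b) (suc c) _ =
  addPairs 0 b c (byComputation (1F ∷ 1F ∷ 2F ∷ 2F ∷ []) rotate₄ rotate₄⁻¹ (2F ∷ 0F ∷ 1F ∷ 0F ∷ []))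
evenRealisable (suc (suc a)) zero zero _ =
  addPairs a 0 0 (byComputation (0F ∷ 0F ∷ 0F ∷ 0F ∷ []) rotate₄ rotate₄⁻¹ (1F ∷ 2F ∷ 1F ∷ 2F ∷ []))
evenRealisable zero (suc (suc b)) zero _ =
  addPairs 0 b 0 (byComputation (1F ∷ 1F ∷ 1F ∷ 1F ∷ []) rotate₄ rotate₄⁻¹ (0F ∷ 2F ∷ 0F ∷ 2F ∷ []))
evenRealisable zero zero (suc (suc c)) _ =
  addPairs 0 0 c (byComputation (2F ∷ 2F ∷ 2F ∷ 2F ∷ []) rotate₄ rotate₄⁻¹ (0F ∷ 1F ∷ 0F ∷ 1F ∷ []))
evenRealisable (suc zero) zero zero (s≤s (s≤s ()))
evenRealisable zero (suc zero) zero (s≤s (s≤s ()))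
evenRealisable zero zero (suc zero) (s≤s (s≤s ()))
evenRealisable zero zero zero ()

realisable : ∀ x y z {q} → x % 2 ≡ q → y % 2 ≡ q → z % 2 ≡ q → q < 2 → 3 ≤ x + y + z →
  Realisable x y z
realisable x y z {q} x≡q y≡q z≡q q<2 3≤x+y+z =
  realisable-cong (sym x-halved) (sym y-halved) (sym z-halved)
    (byHalves {q} {x / 2} {y / 2} {z / 2} q<2
      (subst (3 ≤_) (cong₂ _+_ (cong₂ _+_ x-halved y-halved) z-halved) 3≤x+y+z))
  where
  halve : ∀ m → m % 2 ≡ q → m ≡ q + m / 2 * 2
  halve m refl = m≡m%n+[m/n]*n m 2

  x-halved : x ≡ q + x / 2 * 2
  x-halved = halve x x≡q

  y-halved : y ≡ q + y / 2 * 2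
  y-halved = halve y y≡q

  z-halved : z ≡ q + z / 2 * 2
  z-halved = halve z z≡q

  byHalves : ∀ {q a b c} → q < 2 → 3 ≤ (q + a * 2) + (q + b * 2) + (q + c * 2) →
    Realisable (q + a * 2) (q + b * 2) (q + c * 2)
  byHalves {0} {a} {b} {c} _ = evenRealisable a b c
  byHalves {1} {a} {b} {c} _ _ = addPairs a b c triangle
  byHalves {suc (suc _)} (s≤s (s≤s ()))

realisable⇒extension : ∀ {r} (p : Fin r → Fin 3) {x y z} →
  (∀ c → colourCount p c ≡ (x ∷ y ∷ z ∷ []) c) → Realisable x y z →
  Σ (SimpleGraph r) λ G → TwoRegular G × ProperExtension G p
realisable⇒extension p sizes (_ , τ , C , τ-sizes)
  with π , preserves ← colourMatching p τ (λ c →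
         trans (sym (colourCount-count p c)) (trans (sizes c) (sym (τ-sizes c))))
  = let C′ = transport π preserves C in cycleGraph C′ , cycleGraph-regular C′ , cycleExtension C′

-- Even cycles

parity-suc≢ : ∀ n → parity (suc n) ≢ parity n
parity-suc≢ n e = p≢p⁻¹ (parity (suc n)) (trans e (sym (suc-homo-⁻¹ n)))

parity-even : ∀ n → n % 2 ≡ 0 → parity n ≡ 0ℙ
parity-even 0             _ = refl
parity-even 1             ()
parity-even (suc (suc n)) h = parity-even n h

module EvenCycle {r} (3≤r : 3 ≤ r) (r-even : r % 2 ≡ 0) (c : Fin 3) where

  Follows : Fin r → Fin r → Set
  Follows a b = suc (toℕ a) ≡ toℕ b ⊎ (toℕ b ≡ 0 × suc (toℕ a) ≡ r)

  follows? : ∀ a b → Dec (Follows a b)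
  follows? a b = (suc (toℕ a) ≟ℕ toℕ b) ⊎-dec ((toℕ b ≟ℕ 0) ×-dec (suc (toℕ a) ≟ℕ r))

  cycleAdj⇒follows : ∀ {a b} → CycleAdj a b → Follows a b ⊎ Follows b a
  cycleAdj⇒follows (inj₁ e)                  = inj₁ (inj₁ e)
  cycleAdj⇒follows (inj₂ (inj₁ e))           = inj₂ (inj₁ e)
  cycleAdj⇒follows (inj₂ (inj₂ (inj₁ wrap))) = inj₂ (inj₂ wrap)
  cycleAdj⇒follows (inj₂ (inj₂ (inj₂ wrap))) = inj₁ (inj₂ wrap)

  follows-functional : ∀ {a b b′} → Follows a b → Follows a b′ → b ≡ b′
  follows-functional (inj₁ e) (inj₁ e′) = toℕ-injective (trans (sym e) e′)
  follows-functional {b = b} (inj₁ e) (inj₂ (_ , e′)) = ⊥-elim (<-irrefl (trans (sym e) e′) (toℕ<n b))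
  follows-functional {b′ = b′} (inj₂ (_ , e)) (inj₁ e′) = ⊥-elim (<-irrefl (trans (sym e′) e) (toℕ<n b′))
  follows-functional (inj₂ (b≡0 , _)) (inj₂ (b′≡0 , _)) = toℕ-injective (trans b≡0 (sym b′≡0))

  follows-injective : ∀ {a a′ b} → Follows a b → Follows a′ b → a ≡ a′
  follows-injective (inj₁ e) (inj₁ e′) = toℕ-injective (ℕ-suc-injective (trans e (sym e′)))
  follows-injective (inj₁ e) (inj₂ (b≡0 , _)) with () ← trans e b≡0
  follows-injective (inj₂ (b≡0 , _)) (inj₁ e′) with () ← trans e′ b≡0
  follows-injective (inj₂ (_ , e)) (inj₂ (_ , e′)) = toℕ-injective (ℕ-suc-injective (trans e (sym e′)))

  r≰2 : ¬ r ≤ 2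
  r≰2 r≤2 = <-irrefl refl (≤-trans 3≤r r≤2)

  follows-asym : ∀ {a b} → Follows a b → ¬ Follows b a
  follows-asym {a} (inj₁ e) (inj₁ e′) = m≢1+n+m (toℕ a) (sym (trans (cong suc e) e′))
  follows-asym (inj₁ e) (inj₂ (a≡0 , e′)) =
    r≰2 (≤-reflexive (trans (sym e′) (cong suc (trans (sym e) (cong suc a≡0)))))
  follows-asym (inj₂ (b≡0 , e)) (inj₁ e′) =
    r≰2 (≤-reflexive (trans (sym e) (cong suc (trans (sym e′) (cong suc b≡0)))))
  follows-asym (inj₂ (b≡0 , _)) (inj₂ (_ , e′)) =
    r≰2 (≤-trans (≤-reflexive (trans (sym e′) (cong suc b≡0))) (s≤s z≤n))

  follows-parity : ∀ {a b} → Follows a b → parity (toℕ a) ≢ parity (toℕ b)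
  follows-parity {a} {b} f e = parity-suc≢ (toℕ a) (trans (sym (parity-of-next f)) (sym e))
    where
    parity-of-next : Follows a b → parity (toℕ b) ≡ parity (suc (toℕ a))
    parity-of-next (inj₁ e′)          = cong parity (sym e′)
    parity-of-next (inj₂ (b≡0 , e′))  =
      trans (cong parity b≡0) (trans (sym (parity-even r r-even)) (cong parity (sym e′)))

  parityBit : Parity → Fin 2
  parityBit 0ℙ = 0F
  parityBit 1ℙ = 1F

  tint : Parity → Fin 3
  tint π = punchIn c (parityBit π)

  tint-injective : ∀ {π π′} → tint π ≡ tint π′ → π ≡ π′
  tint-injective {0ℙ} {0ℙ} _ = refl
  tint-injective {1ℙ} {1ℙ} _ = refl
  tint-injective {0ℙ} {1ℙ} e with () ← punchIn-injective c 0F 1F e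
  tint-injective {1ℙ} {0ℙ} e with () ← punchIn-injective c 1F 0F e

  -- The edge from a to its follower is coloured by the parity of a; as r is even, the
  -- wrap-around edge from r − 1 to 0 continues the alternation.
  stripe : Fin r → Fin r → Fin 3
  stripe a b = tint (parity (toℕ (if does (follows? a b) then a else b)))

  stripe-forward : ∀ {a b} → Follows a b → stripe a b ≡ tint (parity (toℕ a))
  stripe-forward {a} {b} f rewrite dec-true (follows? a b) f = refl

  stripe-backward : ∀ {a b} → Follows b a → stripe a b ≡ tint (parity (toℕ b))
  stripe-backward {a} {b} f rewrite dec-false (follows? a b) (λ f′ → follows-asym f′ f) = refl

  stripe-sym : ∀ {a b} → Follows a b ⊎ Follows b a → stripe a b ≡ stripe b a
  stripe-sym (inj₁ f) = trans (stripe-forward f) (sym (stripe-backward f))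
  stripe-sym (inj₂ f) = trans (stripe-backward f) (sym (stripe-forward f))

  stripe-distinct : ∀ {a b b′} → Follows a b ⊎ Follows b a → Follows a b′ ⊎ Follows b′ a → b ≢ b′ →
    stripe a b ≢ stripe a b′
  stripe-distinct (inj₁ f) (inj₁ f′) b≢b′ _ = b≢b′ (follows-functional f f′)
  stripe-distinct (inj₂ f) (inj₂ f′) b≢b′ _ = b≢b′ (follows-injective f f′)
  stripe-distinct (inj₁ f) (inj₂ f′) _ e =
    follows-parity f′ (sym (tint-injective (trans (sym (stripe-forward f)) (trans e (stripe-backward f′)))))
  stripe-distinct (inj₂ f) (inj₁ f′) _ e =
    follows-parity f (tint-injective (trans (sym (stripe-backward f)) (trans e (stripe-forward f′))))

evenCycleExtension : ∀ {r} → 3 ≤ r → r % 2 ≡ 0 → (G : SimpleGraph r) → IsSpanningCycle G →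
  {p : Fin r → Fin 3} (c : Fin 3) → (∀ i → p i ≡ c) → ProperExtension G p
evenCycleExtension {r} 3≤r r-even G (π , isCycle) {p} c monochrome = record
  { col = λ i j → stripe (position i) (position j)
  ; col-sym = λ i j ij → stripe-sym (adjacent ij)
  ; pendant-ok = λ i j _ e → punchInᵢ≢i c _ (trans e (monochrome i))
  ; edges-ok = λ i j l ij il j≢l → stripe-distinct (adjacent ij) (adjacent il) (j≢l ∘ position-injective)
  }
  where
  open EvenCycle 3≤r r-even c

  position : Fin r → Fin r
  position i = π ⟨$⟩ˡ i

  position-injective : ∀ {i j} → position i ≡ position j → i ≡ j
  position-injective e = trans (sym (inverseʳ π)) (trans (cong (π ⟨$⟩ʳ_) e) (inverseʳ π))

  adjacent : ∀ {i j} → adj G i j ≡ true →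
    Follows (position i) (position j) ⊎ Follows (position j) (position i)
  adjacent {i} {j} ij = cycleAdj⇒follows (proj₁ (isCycle (position i) (position j))
    (subst₂ (λ u v → adj G u v ≡ true) (sym (inverseʳ π)) (sym (inverseʳ π)) ij))

monochromatic : ∀ {r} (p : Fin r → Fin 3) c → (∀ d → d ≢ c → colourCount p d ≡ 0) → ∀ i → p i ≡ c
monochromatic p c others i with p i ≟ c
... | yes pi≡c = pi≡c
... | no  pi≢c with () ← trans (sym (dec-true (p i ≟ p i) refl))
                         (count≡0⇒false _ (trans (sym (colourCount-count p (p i))) (others (p i) pi≢c)) i)

corollary5p1 : (r x₁ x₂ x₃ : ℕ) → x₁ + x₂ + x₃ ≡ r → 3 ≤ r →
    (p : Fin r → Fin 3) →
    colourCount p zero ≡ x₁ → colourCount p (suc zero) ≡ x₂ →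
    colourCount p (suc (suc zero)) ≡ x₃ →
    ((Σ (SimpleGraph r) λ G → TwoRegular G × ProperExtension G p)
       ⇔ (x₁ % 2 ≡ r % 2 × x₂ % 2 ≡ r % 2 × x₃ % 2 ≡ r % 2))
    × (¬ (x₁ % 2 ≡ r % 2 × x₂ % 2 ≡ r % 2 × x₃ % 2 ≡ r % 2) →
         (G : SimpleGraph r) → TwoRegular G → ¬ ProperExtension G p)
    × (((x₁ ≢ 0 × x₂ ≡ 0 × x₃ ≡ 0) ⊎ (x₁ ≡ 0 × x₂ ≢ 0 × x₃ ≡ 0)
          ⊎ (x₁ ≡ 0 × x₂ ≡ 0 × x₃ ≢ 0)) →
       r % 2 ≡ 0 →
       (G : SimpleGraph r) → IsSpanningCycle G → ProperExtension G p)
corollary5p1 r x₁ x₂ x₃ total 3≤r p h₁ h₂ h₃ = mk⇔ necessary sufficient , impossible , onCycles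
  where
  sizes : ∀ c → colourCount p c ≡ (x₁ ∷ x₂ ∷ x₃ ∷ []) c
  sizes 0F = h₁
  sizes 1F = h₂
  sizes 2F = h₃

  necessary : (Σ (SimpleGraph r) λ G → TwoRegular G × ProperExtension G p) →
    x₁ % 2 ≡ r % 2 × x₂ % 2 ≡ r % 2 × x₃ % 2 ≡ r % 2
  necessary (G , regular , E) = parityOf 0F , parityOf 1F , parityOf 2F
    where
    parityOf : ∀ c → (x₁ ∷ x₂ ∷ x₃ ∷ []) c % 2 ≡ r % 2
    parityOf c = trans (cong (_% 2) (sym (sizes c))) (colourCount-parity regular E c)

  sufficient : x₁ % 2 ≡ r % 2 × x₂ % 2 ≡ r % 2 × x₃ % 2 ≡ r % 2 →
    Σ (SimpleGraph r) λ G → TwoRegular G × ProperExtension G p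
  sufficient (par₁ , par₂ , par₃) = realisable⇒extension p sizes
    (realisable x₁ x₂ x₃ par₁ par₂ par₃ (m%n<n r 2) (subst (3 ≤_) (sym total) 3≤r))

  impossible : ¬ (x₁ % 2 ≡ r % 2 × x₂ % 2 ≡ r % 2 × x₃ % 2 ≡ r % 2) →
    (G : SimpleGraph r) → TwoRegular G → ¬ ProperExtension G p
  impossible wrongParity G regular E = wrongParity (necessary (G , regular , E))

  onCycles : (x₁ ≢ 0 × x₂ ≡ 0 × x₃ ≡ 0) ⊎ (x₁ ≡ 0 × x₂ ≢ 0 × x₃ ≡ 0) ⊎ (x₁ ≡ 0 × x₂ ≡ 0 × x₃ ≢ 0) →
    r % 2 ≡ 0 → (G : SimpleGraph r) → IsSpanningCycle G → ProperExtension G p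
  onCycles (inj₁ (_ , x₂≡0 , x₃≡0)) r-even G cycle = evenCycleExtension 3≤r r-even G cycle 0F
    (monochromatic p 0F λ { 0F 0≢0 → ⊥-elim (0≢0 refl) ; 1F _ → trans h₂ x₂≡0 ; 2F _ → trans h₃ x₃≡0 })
  onCycles (inj₂ (inj₁ (x₁≡0 , _ , x₃≡0))) r-even G cycle = evenCycleExtension 3≤r r-even G cycle 1F
    (monochromatic p 1F λ { 0F _ → trans h₁ x₁≡0 ; 1F 1≢1 → ⊥-elim (1≢1 refl) ; 2F _ → trans h₃ x₃≡0 })
  onCycles (inj₂ (inj₂ (x₁≡0 , x₂≡0 , _))) r-even G cycle = evenCycleExtension 3≤r r-even G cycle 2F
    (monochromatic p 2F λ { 0F _ → trans h₁ x₁≡0 ; 1F _ → trans h₂ x₂≡0 ; 2F 2≢2 → ⊥-elim (2≢2 refl) })
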